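{- Let $S$ be a signature and $X$ a set of positive integers. For any $S$-term $t$, the equivalence class of $t$ for the relation $\equiv_X$ (where $t\equiv_X t'$ iff $\mathrm{tlt}(X)(t)=\mathrm{tlt}(X)(t')$) is an interval of the $S$-easterly wind poset; more precisely it equals $\{t'\in T(S):\mathrm{tlt}^{\mathrm r}(X)(t)\preceq t'\preceq\mathrm{tlt}(X)(t)\}$.
   Context: A signature is a set $S$ with an arity map $|\cdot|:S\to\mathbb N$. An $S$-term is either the leaf $\ell$ or $s\,t_1\cdots t_{|s|}$ with $s\in S$ and $S$-terms $t_i$; $T(S)$ is the set of $S$-terms. Internal nodes are numbered $1,\dots,\deg t$ in preorder (root, then subterms left to right); $\mathrm{dc}(t)$ is the word of decorations. Children (leaves included) are numbered from $1$ left to right; the parent edge of node $i$ is $(\mathrm{pa}(i),\mathrm{lp}(i),i)$, $i$ being the $\mathrm{lp}(i)$-th child of $\mathrm{pa}(i)$, with $\mathrm{pa}(1)=1,\mathrm{lp}(1)=0$. $\mathrm{cnc}(t)(i)=\mathrm{pa}(i)+1-2^{\mathrm{lp}(i)-a}$ with $a$ the arity of the decoration of $\mathrm{pa}(i)$. The $S$-easterly wind poset is $(T(S),\preceq)$ where $t_1\preceq t_2$ iff $\mathrm{dc}(t_1)=\mathrm{dc}(t_2)$ and $\mathrm{cnc}(t_1)\le\mathrm{cnc}(t_2)$ componentwise. $\mathrm{tlt}(X)(t)$ is obtained by rearranging, for each internal node $i\in X$, its children so that the non-leaf children keep their relative order and precede the leaf children; $\mathrm{tlt}^{\mathrm r}(X)(t)$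 is defined in the same way except that the non-leaf children (in their original relative order) come after the leaf children. -}

module Defs where

open import Data.Nat as ℕ using (ℕ; zero; suc; _∸_; _^_)
open import Data.Nat.Properties using (m^n≢0)
open import Data.Bool using (Bool; true; false; if_then_else_)
open import Data.Product using (_×_; _,_)
open import Data.List using (List; []; _∷_; _++_; map)
open import Data.List.Relation.Binary.Pointwise using (Pointwise)
open import Data.Vec using (Vec; []; _∷_; _∷ʳ_)
open import Data.Integer using (+_)
open import Data.Rational using (ℚ; _/_; _-_; _≤_)
open import Relation.Binary.PropositionalEquality using (_≡_)

record Signature : Set₁ where
  field
    Sym   : Set
    arity : Sym → ℕ
open Signature public

module _ (Σ : Signature) where

  data Term : Set where
    leaf : Term
    node : (s : Sym Σ) → Vec Term (arity Σ s) → Term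

  mutual
    deg : Term → ℕ
    deg leaf = 0
    deg (node s ts) = suc (degs ts)

    degs : ∀ {k} → Vec Term k → ℕ
    degs [] = 0
    degs (t ∷ ts) = deg t ℕ.+ degs ts

  mutual
    dc : Term → List (Sym Σ)
    dc leaf = []
    dc (node s ts) = s ∷ dcs ts

    dcs : ∀ {k} → Vec Term k → List (Sym Σ)
    dcs [] = []
    dcs (t ∷ ts) = dc t ++ dcs ts

  -- For each internal node i (in preorder), the triple
  -- (pa(i), lp(i), arity of the decoration of pa(i)).
  -- 'info n p l a t': t is the l-th child of node p (whose decoration has arity a),
  -- and the root of t (if internal) has preorder number n.
  mutual
    info : ℕ → ℕ → ℕ → ℕ → Term → List (ℕ × ℕ × ℕ)
    info n p l a leaf = []
    info n p l a (node s ts) = (p , l , a) ∷ infos n (arity Σ s) 1 (suc n) ts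

    -- children of node pn (arity ar), starting at child position pos,
    -- the next internal node having preorder number nx
    infos : ∀ {k} → ℕ → ℕ → ℕ → ℕ → Vec Term k → List (ℕ × ℕ × ℕ)
    infos pn ar pos nx [] = []
    infos pn ar pos nx (t ∷ ts) =
      info nx pn pos ar t ++ infos pn ar (suc pos) (nx ℕ.+ deg t) ts

  -- root: pa(1) = 1, lp(1) = 0
  parentInfo : Term → List (ℕ × ℕ × ℕ)
  parentInfo leaf = []
  parentInfo (node s ts) = (1 , 0 , arity Σ s) ∷ infos 1 (arity Σ s) 1 2 ts

  -- 2^(l - a) for l ≤ a, i.e. 1 / 2^(a - l)
  twoPowNeg : ℕ → ℚ
  twoPowNeg k = (+ 1 / (2 ^ k)) {{m^n≢0 2 k}}

  cnc : Term → List ℚ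
  cnc t = map (λ { (p , l , a) → (+ (suc p) / 1) - twoPowNeg (a ∸ l) }) (parentInfo t)

  _≼_ : Term → Term → Set
  t₁ ≼ t₂ = (dc t₁ ≡ dc t₂) × Pointwise _≤_ (cnc t₁) (cnc t₂)

  isLeaf : Term → Bool
  isLeaf leaf = true
  isLeaf (node _ _) = false

  leavesRight : ∀ {k} → Vec Term k → Vec Term k
  leavesRight [] = []
  leavesRight (leaf ∷ ts) = leavesRight ts ∷ʳ leaf
  leavesRight (node s us ∷ ts) = node s us ∷ leavesRight ts

  insertAfterLeaves : ∀ {k} → Term → Vec Term k → Vec Term (suc k)
  insertAfterLeaves t [] = t ∷ []
  insertAfterLeaves t (leaf ∷ us) = leaf ∷ insertAfterLeaves t us
  insertAfterLeaves t (node s vs ∷ us) = t ∷ node s vs ∷ us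

  leavesLeft : ∀ {k} → Vec Term k → Vec Term k
  leavesLeft [] = []
  leavesLeft (leaf ∷ ts) = leaf ∷ leavesLeft ts
  leavesLeft (node s us ∷ ts) = insertAfterLeaves (node s us) (leavesLeft ts)

  -- Generic tilting: 'rearr' applied at each internal node whose (original,
  -- preorder) number is in X. Argument n = preorder number of the root of t in
  -- the original term.
  module Tilt (rearr : ∀ {k} → Vec Term k → Vec Term k) (X : ℕ → Bool) where
    mutual
      go : ℕ → Term → Term
      go n leaf = leaf
      go n (node s ts) =
        node s ((if X n then rearr else (λ v → v)) (gos (suc n) ts))

      gos : ∀ {k} → ℕ → Vec Term k → Vec Term k
      gos nx [] = []
      gos nx (t ∷ ts) = go nx t ∷ gos (nx ℕ.+ deg t) ts

  tlt : (ℕ → Bool) → Term → Term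
  tlt X t = Tilt.go leavesRight X 1 t

  tltʳ : (ℕ → Bool) → Term → Term
  tltʳ X t = Tilt.go leavesLeft X 1 t

  _≡[_]_ : Term → (ℕ → Bool) → Term → Set
  t ≡[ X ] t' = tlt X t ≡ tlt X t'

-- cnc(i) = pa(i) + 1 − 2^(lp(i) − a) lies in [pa(i), pa(i) + 1), so cnc values compare parents
-- first and then the distances of the nodes from the last child position. Tilting only moves leaves:
-- it keeps dc and every parent, and tlt moves internal children to the left, tltʳ to the right, so
-- tltʳ t ≼ t ≼ tlt t. At the nodes of X both tilts only depend on the sequence of internal children,
-- hence tltʳ ∘ tlt = tltʳ, which gives one inclusion. Conversely, if tltʳ t ≼ t' ≼ tlt t, the parents
-- of t' are squeezed between equal ones, so t' has the internal skeleton of t, and by induction its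
-- internal children tilt to those of t; outside X their positions are squeezed between those of t as
-- well, so tlt t' = tlt t.

module Submission where

open import Defs
open import Data.Nat as ℕ using (ℕ; zero; suc; _+_; _∸_; _^_; _≤_; _<_; z≤n; s≤s)
import Data.Nat.Properties as ℕ
import Data.Nat.GCD as ℕ
open import Data.Integer as ℤ using (+_)
import Data.Integer.Properties as ℤ
import Data.Integer.GCD as ℤ
open import Data.Rational as ℚ using (ℚ; _/_; ↥_; ↧_; 0ℚ; 1ℚ)
import Data.Rational.Properties as ℚ
import Data.Rational.Unnormalised as ℚᵘ
import Data.Rational.Unnormalised.Properties as ℚᵘ
open import Data.Bool using (Bool; true; false; if_then_else_)
open import Data.Empty using (⊥; ⊥-elim)
open import Data.Unit using (⊤; tt)
open import Data.Product using (_×_; _,_; proj₁; proj₂; ∃-syntax)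
open import Data.List as List using (List; []; _∷_; _++_; map; concat; length)
import Data.List.Properties as List
open import Data.Nat.ListAction using (sum)
open import Data.List.Relation.Binary.Pointwise as Pointwise using (Pointwise; []; _∷_)
open import Data.List.Relation.Unary.All as All using (All; []; _∷_)
import Data.List.Relation.Unary.All.Properties as AllP
open import Data.Vec using (Vec; []; _∷_; _∷ʳ_)
open import Function using (_∘_; flip)
open import Function.Bundles using (_⇔_; mk⇔)
open import Relation.Binary.PropositionalEquality

↥↧-coprime-/ : ∀ i n .{{_ : ℕ.NonZero n}} → ℤ.gcd i (+ n) ≡ + 1 → ↥ (i / n) ≡ i × ↧ (i / n) ≡ + n
↥↧-coprime-/ i n g≡1 = cancel (ℚ.↥-/ i n) , cancel (ℚ.↧-/ i n)
  where
  cancel : ∀ {x y} → x ℤ.* ℤ.gcd i (+ n) ≡ y → x ≡ y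
  cancel {x} e = trans (sym (ℤ.*-identityʳ x)) (trans (cong (x ℤ.*_) (sym g≡1)) e)

-- twoPowNeg of Defs, which does not actually depend on the signature.
½^_ : ℕ → ℚ
½^ k = (+ 1 / 2 ^ k) {{ℕ.m^n≢0 2 k}}

⌜_⌝ : ℕ → ℚ
⌜ n ⌝ = + n / 1

↥⌜⌝ : ∀ n → ↥ ⌜ n ⌝ ≡ + n
↥⌜⌝ n = proj₁ (↥↧-coprime-/ (+ n) 1 (cong +_ (ℕ.gcd-zeroʳ n)))

↧⌜⌝ : ∀ n → ↧ ⌜ n ⌝ ≡ + 1
↧⌜⌝ n = proj₂ (↥↧-coprime-/ (+ n) 1 (cong +_ (ℕ.gcd-zeroʳ n)))

↥½^ : ∀ k → ↥ (½^ k) ≡ + 1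
↥½^ k = proj₁ (↥↧-coprime-/ (+ 1) (2 ^ k) {{ℕ.m^n≢0 2 k}} (cong +_ (ℕ.gcd-zeroˡ (2 ^ k))))

↧½^ : ∀ k → ↧ (½^ k) ≡ + (2 ^ k)
↧½^ k = proj₂ (↥↧-coprime-/ (+ 1) (2 ^ k) {{ℕ.m^n≢0 2 k}} (cong +_ (ℕ.gcd-zeroˡ (2 ^ k))))

½^-pos : ∀ k → 0ℚ ℚ.< ½^ k
½^-pos k = ℚ.positive⁻¹ (½^ k) {{ℚ.normalize-pos 1 (2 ^ k) {{ℕ.m^n≢0 2 k}}}}

½^-suc< : ∀ k → ½^ (suc k) ℚ.< ½^ k
½^-suc< k = ℚ.*<* (subst₂ ℤ._<_
  (cong₂ ℤ._*_ (sym (↥½^ (suc k))) (sym (↧½^ k)))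
  (cong₂ ℤ._*_ (sym (↥½^ k)) (sym (↧½^ (suc k))))
  (subst₂ ℤ._<_ (sym (ℤ.*-identityˡ _)) (sym (ℤ.*-identityˡ _))
    (ℤ.+<+ (ℕ.m<m+n (2 ^ k) (subst (0 ℕ.<_) (sym (ℕ.*-identityˡ (2 ^ k))) (ℕ.m^n>0 2 k))))))

½^-antitone : ∀ {k k'} → k ℕ.≤ k' → ½^ k' ℚ.≤ ½^ k
½^-antitone k≤k' = go (ℕ.≤⇒≤′ k≤k')
  where
  go : ∀ {k k'} → k ℕ.≤′ k' → ½^ k' ℚ.≤ ½^ k
  go ℕ.≤′-refl = ℚ.≤-refl
  go (ℕ.≤′-step {n} p) = ℚ.≤-trans (ℚ.<⇒≤ (½^-suc< n)) (go p)

⌜⌝-mono : ∀ {m n} → m ℕ.≤ n → ⌜ m ⌝ ℚ.≤ ⌜ n ⌝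
⌜⌝-mono {m} {n} m≤n = ℚ.*≤* (subst₂ ℤ._≤_
  (cong₂ ℤ._*_ (sym (↥⌜⌝ m)) (sym (↧⌜⌝ n))) (cong₂ ℤ._*_ (sym (↥⌜⌝ n)) (sym (↧⌜⌝ m)))
  (ℤ.*-monoʳ-≤-nonNeg (+ 1) (ℤ.+≤+ m≤n)))

toℚᵘ-⌜⌝ : ∀ n → ℚ.toℚᵘ ⌜ n ⌝ ℚᵘ.≃ ℚᵘ.mkℚᵘ (+ n) 0
toℚᵘ-⌜⌝ n = ℚᵘ.*≡* (cong₂ ℤ._*_ (trans (ℚ.↥ᵘ-toℚᵘ ⌜ n ⌝) (↥⌜⌝ n))
                                 (sym (trans (ℚ.↧ᵘ-toℚᵘ ⌜ n ⌝) (↧⌜⌝ n))))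

⌜⌝-suc : ∀ n → ⌜ suc n ⌝ ℚ.+ 1ℚ ≡ ⌜ suc (suc n) ⌝
⌜⌝-suc n = ℚ.toℚᵘ-injective (begin
  ℚ.toℚᵘ (⌜ suc n ⌝ ℚ.+ 1ℚ)                 ≈⟨ ℚ.toℚᵘ-homo-+ ⌜ suc n ⌝ 1ℚ ⟩
  ℚ.toℚᵘ ⌜ suc n ⌝ ℚᵘ.+ ℚ.toℚᵘ 1ℚ
    ≈⟨ ℚᵘ.+-congˡ (ℚ.toℚᵘ 1ℚ) (toℚᵘ-⌜⌝ (suc n)) ⟩
  ℚᵘ.mkℚᵘ (+ suc n) 0 ℚᵘ.+ ℚᵘ.mkℚᵘ (+ 1) 0
    ≈⟨ ℚᵘ.*≡* (cong (λ m → + suc m) (trans (ℕ.*-identityʳ _) (ℕ.+-comm _ 1))) ⟩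
  ℚᵘ.mkℚᵘ (+ suc (suc n)) 0                 ≈⟨ ℚᵘ.≃-sym (toℚᵘ-⌜⌝ (suc (suc n))) ⟩
  ℚ.toℚᵘ ⌜ suc (suc n) ⌝                    ∎)
  where open ℚᵘ.≃-Reasoning

-- cnc(i) = pa(i) + 1 − 2^(lp(i) − a), with k = a − lp(i).
edgeValue : ℕ → ℕ → ℚ
edgeValue p k = ⌜ suc p ⌝ ℚ.- ½^ k

edgeValue-mono : ∀ p {k k'} → k ℕ.≤ k' → edgeValue p k ℚ.≤ edgeValue p k'
edgeValue-mono p k≤k' = ℚ.+-monoʳ-≤ ⌜ suc p ⌝ (ℚ.neg-antimono-≤ (½^-antitone k≤k'))

edgeValue-mono-< : ∀ p {k k'} → k ℕ.< k' → edgeValue p k ℚ.< edgeValue p k'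
edgeValue-mono-< p {k} k<k' = ℚ.+-monoʳ-< ⌜ suc p ⌝
  (ℚ.neg-antimono-< (ℚ.≤-<-trans (½^-antitone k<k') (½^-suc< k)))

edgeValue-cancel : ∀ p {k k'} → edgeValue p k ℚ.≤ edgeValue p k' → k ℕ.≤ k'
edgeValue-cancel p {k} {k'} v≤v' = ℕ.≮⇒≥ λ k'<k → ℚ.<-irrefl refl (ℚ.<-≤-trans (edgeValue-mono-< p k'<k) v≤v')

edgeValue<⌜suc⌝ : ∀ p k → edgeValue p k ℚ.< ⌜ suc p ⌝
edgeValue<⌜suc⌝ p k = subst (edgeValue p k ℚ.<_) (ℚ.+-identityʳ ⌜ suc p ⌝)
  (ℚ.+-monoʳ-< ⌜ suc p ⌝ (ℚ.neg-antimono-< (½^-pos k)))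

⌜⌝≤edgeValue : ∀ p k → ⌜ suc p ⌝ ℚ.≤ edgeValue (suc p) k
⌜⌝≤edgeValue p k = begin
  ⌜ suc p ⌝                              ≡⟨ x+e-e≡x ⌜ suc p ⌝ (½^ k) ⟨
  ⌜ suc p ⌝ ℚ.+ ½^ k ℚ.- ½^ k
    ≤⟨ ℚ.+-monoˡ-≤ (ℚ.- ½^ k) (ℚ.+-monoʳ-≤ ⌜ suc p ⌝ (½^-antitone {0} {k} z≤n)) ⟩
  ⌜ suc p ⌝ ℚ.+ 1ℚ ℚ.- ½^ k              ≡⟨ cong (ℚ._- ½^ k) (⌜⌝-suc p) ⟩
  edgeValue (suc p) k                    ∎
  where
  open ℚ.≤-Reasoning
  x+e-e≡x : ∀ x e → x ℚ.+ e ℚ.- e ≡ x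
  x+e-e≡x x e = trans (ℚ.+-assoc x e (ℚ.- e)) (trans (cong (x ℚ.+_) (ℚ.+-inverseʳ e)) (ℚ.+-identityʳ x))

-- Since p ≤ edgeValue p k < p + 1, edge values are ordered lexicographically, parent first.
edgeValue-parent-mono : ∀ {p p' k k'} → edgeValue p k ℚ.≤ edgeValue p' k' → p ℕ.≤ p'
edgeValue-parent-mono {suc q} {p'} {k} {k'} v≤v' = ℕ.≮⇒≥ λ { (ℕ.s≤s p'≤q) →
  ℚ.<-irrefl refl (ℚ.<-≤-trans (edgeValue<⌜suc⌝ p' k')
    (ℚ.≤-trans (⌜⌝-mono (ℕ.s≤s p'≤q)) (ℚ.≤-trans (⌜⌝≤edgeValue q k) v≤v'))) }
edgeValue-parent-mono {zero} _ = ℕ.z≤n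

module _ {A B : Set} where

  map-proj₁-proj₂-injective : {xs ys : List (A × B)} →
    map proj₁ xs ≡ map proj₁ ys → map proj₂ xs ≡ map proj₂ ys → xs ≡ ys
  map-proj₁-proj₂-injective {[]} {[]} _ _ = refl
  map-proj₁-proj₂-injective {x ∷ xs} {y ∷ ys} e₁ e₂ =
    cong₂ _∷_ (cong₂ _,_ (List.∷-injectiveˡ e₁) (List.∷-injectiveˡ e₂))
              (map-proj₁-proj₂-injective (List.∷-injectiveʳ e₁) (List.∷-injectiveʳ e₂))

module _ {A : Set} where

  ++-injective : (xs ys : List A) {as bs : List A} → length xs ≡ length ys →
    xs ++ as ≡ ys ++ bs → xs ≡ ys × as ≡ bs
  ++-injective [] [] _ e = refl , e
  ++-injective (x ∷ xs) (y ∷ ys) l e with List.∷-injective e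
  ... | refl , e′ with ++-injective xs ys (ℕ.suc-injective l) e′
  ...   | refl , e″ = refl , e″

∸-injective* : ∀ {a xs ys} → All (_≤ a) xs → All (_≤ a) ys →
  Pointwise (λ x y → a ∸ x ≤ a ∸ y) xs ys → Pointwise (λ y x → a ∸ y ≤ a ∸ x) ys xs → xs ≡ ys
∸-injective* [] [] [] [] = refl
∸-injective* (x≤a ∷ xs≤a) (y≤a ∷ ys≤a) (h ∷ hs) (h' ∷ hs') =
  cong₂ _∷_ (ℕ.∸-cancelˡ-≡ x≤a y≤a (ℕ.≤-antisym h h')) (∸-injective* xs≤a ys≤a hs hs')

-- A concatenation of segments, each opening with the only element of key k, can be cut
-- back into its segments along any relation that preserves keys.
module Segments {A K : Set} {R : A → A → Set} (key : A → K) (k : K)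
                (R⇒key≡ : ∀ {x y} → R x y → key x ≡ key y) where

  Opens : List A → Set
  Opens []      = ⊤
  Opens (x ∷ _) = key x ≡ k

  Segment : List A → Set
  Segment []       = ⊥
  Segment (x ∷ xs) = key x ≡ k × All (λ y → key y ≢ k) xs

  concat-opens : ∀ {xss} → All Segment xss → Opens (concat xss)
  concat-opens []                        = tt
  concat-opens {(_ ∷ _) ∷ _} ((o , _) ∷ _) = o

  private
    ++⁻ : ∀ {xs ys as bs} → All (λ y → key y ≢ k) xs → All (λ y → key y ≢ k) ys →
          Opens as → Opens bs → Pointwise R (xs ++ as) (ys ++ bs) → Pointwise R xs ys × Pointwise R as bs
    ++⁻ [] [] _ _ r = [] , r
    ++⁻ {ys = _ ∷ _} {_ ∷ _} [] (y≢ ∷ _) oa _ (r ∷ _) = ⊥-elim (y≢ (trans (sym (R⇒key≡ r)) oa))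
    ++⁻ {xs = _ ∷ _} {bs = _ ∷ _} (x≢ ∷ _) [] _ ob (r ∷ _) = ⊥-elim (x≢ (trans (R⇒key≡ r) ob))
    ++⁻ (_ ∷ xs≢) (_ ∷ ys≢) oa ob (r ∷ rs) with ++⁻ xs≢ ys≢ oa ob rs
    ... | rxs , ras = r ∷ rxs , ras

  concat⁻ : ∀ {xss yss} → All Segment xss → All Segment yss →
    Pointwise R (concat xss) (concat yss) → Pointwise (Pointwise R) xss yss
  concat⁻ [] [] _ = []
  concat⁻ {yss = (_ ∷ _) ∷ _} [] (_ ∷ _) ()
  concat⁻ {xss = (_ ∷ _) ∷ _} (_ ∷ _) [] ()
  concat⁻ {(_ ∷ _) ∷ _} {(_ ∷ _) ∷ _} ((_ , xs≢) ∷ sx) ((_ , ys≢) ∷ sy) (r ∷ rs)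
    with ++⁻ xs≢ ys≢ (concat-opens sx) (concat-opens sy) rs
  ... | rxs , rest = (r ∷ rxs) ∷ concat⁻ sx sy rest

-- An entry (pa(i), lp(i), a) of parentInfo; a ∸ lp(i) is the distance of node i from the last child position.
Entry : Set
Entry = ℕ × ℕ × ℕ

parent : Entry → ℕ
parent (p , _ , _) = p

data _≤ᵉ_ : Entry → Entry → Set where
  sameParent : ∀ {p l a l' a'} → a ∸ l ≤ a' ∸ l' → (p , l , a) ≤ᵉ (p , l' , a')

≤ᵉ-refl : ∀ {e} → e ≤ᵉ e
≤ᵉ-refl = sameParent ℕ.≤-refl

≤ᵉ⇒parent≡ : ∀ {e e'} → e ≤ᵉ e' → parent e ≡ parent e'
≤ᵉ⇒parent≡ (sameParent _) = refl

≤ᵉ-trans : ∀ {e e' e''} → e ≤ᵉ e' → e' ≤ᵉ e'' → e ≤ᵉ e''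
≤ᵉ-trans (sameParent k≤k') (sameParent k'≤k'') = sameParent (ℕ.≤-trans k≤k' k'≤k'')

≤ᵉ*-refl : ∀ {es} → Pointwise _≤ᵉ_ es es
≤ᵉ*-refl = Pointwise.refl ≤ᵉ-refl

≤ᵉ*-trans : ∀ {es es' es''} → Pointwise _≤ᵉ_ es es' → Pointwise _≤ᵉ_ es' es'' → Pointwise _≤ᵉ_ es es''
≤ᵉ*-trans = Pointwise.transitive ≤ᵉ-trans

entryValue : Entry → ℚ
entryValue (p , l , a) = edgeValue p (a ∸ l)

≤ᵉ⇒entryValue≤ : ∀ {e e'} → e ≤ᵉ e' → entryValue e ℚ.≤ entryValue e'
≤ᵉ⇒entryValue≤ {p , _ , _} (sameParent k≤k') = edgeValue-mono p k≤k'

-- Comparing entry values only pins down the parents when they are squeezed between two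
-- entries with equal parents; then it is exactly ≤ᵉ.
sandwich : ∀ {xs ys zs} → Pointwise _≤ᵉ_ xs zs →
  Pointwise ℚ._≤_ (map entryValue xs) (map entryValue ys) →
  Pointwise ℚ._≤_ (map entryValue ys) (map entryValue zs) →
  Pointwise _≤ᵉ_ xs ys × Pointwise _≤ᵉ_ ys zs
sandwich xz xy yz = go xz (Pointwise.map⁻ entryValue entryValue xy) (Pointwise.map⁻ entryValue entryValue yz)
  where
  go : ∀ {xs ys zs} → Pointwise _≤ᵉ_ xs zs →
    Pointwise (λ x y → entryValue x ℚ.≤ entryValue y) xs ys →
    Pointwise (λ y z → entryValue y ℚ.≤ entryValue z) ys zs →
    Pointwise _≤ᵉ_ xs ys × Pointwise _≤ᵉ_ ys zs
  go [] [] [] = [] , []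
  go {(p , l , a) ∷ _} {(p' , l' , a') ∷ _} {(_ , l'' , a'') ∷ _} (sameParent _ ∷ xz) (x≤y ∷ xy) (y≤z ∷ yz)
    with ℕ.≤-antisym (edgeValue-parent-mono {p} {p'} {a ∸ l} {a' ∸ l'} x≤y)
                     (edgeValue-parent-mono {p'} {p} {a' ∸ l'} {a'' ∸ l''} y≤z)
  ... | refl with go xz xy yz
  ...   | xy′ , yz′ = sameParent (edgeValue-cancel p x≤y) ∷ xy′ , sameParent (edgeValue-cancel p y≤z) ∷ yz′

module _ (Σ : Signature) where

  private
    Tm : Set
    Tm = Term Σ

  internals : ∀ {k} → Vec Tm k → List Tm
  internals []               = []
  internals (leaf ∷ ts)      = internals ts
  internals (node s us ∷ ts) = node s us ∷ internals ts

  internals-length≤ : ∀ {k} (v : Vec Tm k) → length (internals v) ≤ k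
  internals-length≤ []               = z≤n
  internals-length≤ (leaf ∷ ts)      = ℕ.m≤n⇒m≤1+n (internals-length≤ ts)
  internals-length≤ (node s us ∷ ts) = s≤s (internals-length≤ ts)

  dcs-internals : ∀ {k} (v : Vec Tm k) → dcs Σ v ≡ concat (map (dc Σ) (internals v))
  dcs-internals []               = refl
  dcs-internals (leaf ∷ ts)      = dcs-internals ts
  dcs-internals (node s us ∷ ts) = cong (dc Σ (node s us) ++_) (dcs-internals ts)

  degs-internals : ∀ {k} (v : Vec Tm k) → degs Σ v ≡ sum (map (deg Σ) (internals v))
  degs-internals []               = refl
  degs-internals (leaf ∷ ts)      = degs-internals ts
  degs-internals (node s us ∷ ts) = cong (_+_ (deg Σ (node s us))) (degs-internals ts)

  mutual
    length-dc : ∀ t → length (dc Σ t) ≡ deg Σ t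
    length-dc leaf        = refl
    length-dc (node s ts) = cong suc (length-dcs ts)

    length-dcs : ∀ {k} (v : Vec Tm k) → length (dcs Σ v) ≡ degs Σ v
    length-dcs []       = refl
    length-dcs (t ∷ ts) = trans (List.length-++ (dc Σ t)) (cong₂ _+_ (length-dc t) (length-dcs ts))

  internals-∷ʳ-leaf : ∀ {k} (v : Vec Tm k) → internals (v ∷ʳ leaf) ≡ internals v
  internals-∷ʳ-leaf []               = refl
  internals-∷ʳ-leaf (leaf ∷ ts)      = internals-∷ʳ-leaf ts
  internals-∷ʳ-leaf (node s us ∷ ts) = cong (node s us ∷_) (internals-∷ʳ-leaf ts)

  internals-insertAfterLeaves : ∀ {k} s us (v : Vec Tm k) →
    internals (insertAfterLeaves Σ (node s us) v) ≡ node s us ∷ internals v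
  internals-insertAfterLeaves s us []                 = refl
  internals-insertAfterLeaves s us (leaf ∷ ts)        = internals-insertAfterLeaves s us ts
  internals-insertAfterLeaves s us (node s' us' ∷ ts) = refl

  internals-leavesRight : ∀ {k} (v : Vec Tm k) → internals (leavesRight Σ v) ≡ internals v
  internals-leavesRight []               = refl
  internals-leavesRight (leaf ∷ ts)      = trans (internals-∷ʳ-leaf (leavesRight Σ ts)) (internals-leavesRight ts)
  internals-leavesRight (node s us ∷ ts) = cong (node s us ∷_) (internals-leavesRight ts)

  internals-leavesLeft : ∀ {k} (v : Vec Tm k) → internals (leavesLeft Σ v) ≡ internals v
  internals-leavesLeft []               = refl
  internals-leavesLeft (leaf ∷ ts)      = internals-leavesLeft ts
  internals-leavesLeft (node s us ∷ ts) =
    trans (internals-insertAfterLeaves s us (leavesLeft Σ ts)) (cong (node s us ∷_) (internals-leavesLeft ts))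

  fillRight : (k : ℕ) → List Tm → Vec Tm k
  fillRight zero    _        = []
  fillRight (suc k) []       = leaf ∷ fillRight k []
  fillRight (suc k) (c ∷ cs) = c ∷ fillRight k cs

  fillLeft : (k : ℕ) → List Tm → Vec Tm k
  fillLeft zero    _        = []
  fillLeft (suc k) []       = leaf ∷ fillLeft k []
  fillLeft (suc k) (c ∷ cs) = insertAfterLeaves Σ c (fillLeft k cs)

  fillRight-∷ʳ-leaf : ∀ k cs → length cs ≤ k → fillRight k cs ∷ʳ leaf ≡ fillRight (suc k) cs
  fillRight-∷ʳ-leaf zero    []       _         = refl
  fillRight-∷ʳ-leaf (suc k) []       _         = cong (leaf ∷_) (fillRight-∷ʳ-leaf k [] z≤n)
  fillRight-∷ʳ-leaf (suc k) (c ∷ cs) (s≤s cs≤k) = cong (c ∷_) (fillRight-∷ʳ-leaf k cs cs≤k)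

  leaf∷fillLeft : ∀ k cs → length cs ≤ k → leaf ∷ fillLeft k cs ≡ fillLeft (suc k) cs
  leaf∷fillLeft k       []       _          = refl
  leaf∷fillLeft (suc k) (c ∷ cs) (s≤s cs≤k) = cong (insertAfterLeaves Σ c) (leaf∷fillLeft k cs cs≤k)

  leavesRight-fillRight : ∀ {k} (v : Vec Tm k) → leavesRight Σ v ≡ fillRight k (internals v)
  leavesRight-fillRight []                       = refl
  leavesRight-fillRight {suc k} (leaf ∷ ts)      =
    trans (cong (_∷ʳ leaf) (leavesRight-fillRight ts)) (fillRight-∷ʳ-leaf k (internals ts) (internals-length≤ ts))
  leavesRight-fillRight (node s us ∷ ts)         = cong (node s us ∷_) (leavesRight-fillRight ts)

  leavesLeft-fillLeft : ∀ {k} (v : Vec Tm k) → leavesLeft Σ v ≡ fillLeft k (internals v)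
  leavesLeft-fillLeft []                       = refl
  leavesLeft-fillLeft {suc k} (leaf ∷ ts)      =
    trans (cong (leaf ∷_) (leavesLeft-fillLeft ts)) (leaf∷fillLeft k (internals ts) (internals-length≤ ts))
  leavesLeft-fillLeft (node s us ∷ ts)         = cong (insertAfterLeaves Σ (node s us)) (leavesLeft-fillLeft ts)

  Rearrangement : Set
  Rearrangement = ∀ {k} → Vec Tm k → Vec Tm k

  PreservesInternals : Rearrangement → Set
  PreservesInternals r = ∀ {k} (v : Vec Tm k) → internals (r v) ≡ internals v

  DeterminedByInternals : Rearrangement → Set
  DeterminedByInternals r = ∀ {k} (v w : Vec Tm k) → internals v ≡ internals w → r v ≡ r w

  leavesRight-determined : DeterminedByInternals (leavesRight Σ)
  leavesRight-determined {k} v w e =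
    trans (leavesRight-fillRight v) (trans (cong (fillRight k) e) (sym (leavesRight-fillRight w)))

  leavesLeft-determined : DeterminedByInternals (leavesLeft Σ)
  leavesLeft-determined {k} v w e =
    trans (leavesLeft-fillLeft v) (trans (cong (fillLeft k) e) (sym (leavesLeft-fillLeft w)))

  dcs-resp-internals : ∀ {k} (v w : Vec Tm k) → internals v ≡ internals w → dcs Σ v ≡ dcs Σ w
  dcs-resp-internals v w e = trans (dcs-internals v) (trans (cong (concat ∘ map (dc Σ)) e) (sym (dcs-internals w)))

  degs-resp-internals : ∀ {k} (v w : Vec Tm k) → internals v ≡ internals w → degs Σ v ≡ degs Σ w
  degs-resp-internals v w e = trans (degs-internals v) (trans (cong (sum ∘ map (deg Σ)) e) (sym (degs-internals w)))

  -- Preorder numbers of the roots of consecutive sibling subtrees, the first one being nx.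
  numbered : ℕ → List Tm → List (ℕ × Tm)
  numbered nx []       = []
  numbered nx (c ∷ cs) = (nx , c) ∷ numbered (nx + deg Σ c) cs

  map-proj₂-numbered : ∀ nx cs → map proj₂ (numbered nx cs) ≡ cs
  map-proj₂-numbered nx []       = refl
  map-proj₂-numbered nx (c ∷ cs) = cong (c ∷_) (map-proj₂-numbered _ cs)

  IsInternalChild : ℕ × ℕ × Tm → Set
  IsInternalChild (_ , _ , c) = isLeaf Σ c ≡ false

  -- The internal children of a vector of subterms, each with its position (the first child being
  -- at position pos) and its preorder number (the first internal one being nx).
  internalChildren : ℕ → ℕ → ∀ {k} → Vec Tm k → List (ℕ × ℕ × Tm)
  internalChildren pos nx []               = []
  internalChildren pos nx (leaf ∷ ts)      = internalChildren (suc pos) (nx + 0) ts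
  internalChildren pos nx (node s us ∷ ts) = (pos , nx , node s us) ∷ internalChildren (suc pos) (nx + deg Σ (node s us)) ts

  map-proj₂-internalChildren : ∀ pos nx {k} (v : Vec Tm k) → map proj₂ (internalChildren pos nx v) ≡ numbered nx (internals v)
  map-proj₂-internalChildren pos nx []               = refl
  map-proj₂-internalChildren pos nx (leaf ∷ ts)      rewrite ℕ.+-identityʳ nx = map-proj₂-internalChildren (suc pos) nx ts
  map-proj₂-internalChildren pos nx (node s us ∷ ts) = cong (_ ∷_) (map-proj₂-internalChildren (suc pos) _ ts)

  internalChildren-pos≥ : ∀ pos nx {k} (v : Vec Tm k) → All (λ e → pos ≤ proj₁ e) (internalChildren pos nx v)
  internalChildren-pos≥ pos nx []               = []
  internalChildren-pos≥ pos nx (leaf ∷ ts)      = All.map (ℕ.≤-trans (ℕ.n≤1+n pos)) (internalChildren-pos≥ (suc pos) _ ts)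
  internalChildren-pos≥ pos nx (node s us ∷ ts) =
    ℕ.≤-refl ∷ All.map (ℕ.≤-trans (ℕ.n≤1+n pos)) (internalChildren-pos≥ (suc pos) _ ts)

  internalChildren-pos< : ∀ pos nx {k} (v : Vec Tm k) → All (λ e → proj₁ e < pos + k) (internalChildren pos nx v)
  internalChildren-pos< pos nx []                       = []
  internalChildren-pos< pos nx {suc k} (leaf ∷ ts)      rewrite ℕ.+-suc pos k = internalChildren-pos< (suc pos) _ ts
  internalChildren-pos< pos nx {suc k} (node s us ∷ ts) rewrite ℕ.+-suc pos k =
    s≤s (ℕ.m≤m+n pos k) ∷ internalChildren-pos< (suc pos) _ ts

  internalChildren-injective : ∀ pos nx {k} (v w : Vec Tm k) → internalChildren pos nx v ≡ internalChildren pos nx w → v ≡ w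
  internalChildren-injective pos nx [] [] _ = refl
  internalChildren-injective pos nx (leaf ∷ v) (leaf ∷ w) e = cong (leaf ∷_) (internalChildren-injective (suc pos) _ v w e)
  internalChildren-injective pos nx (leaf ∷ v) (node s us ∷ w) e =
    ⊥-elim (ℕ.<-irrefl refl (All.head (subst (All (λ x → suc pos ≤ proj₁ x)) e (internalChildren-pos≥ (suc pos) _ v))))
  internalChildren-injective pos nx (node s us ∷ v) (leaf ∷ w) e =
    ⊥-elim (ℕ.<-irrefl refl (All.head (subst (All (λ x → suc pos ≤ proj₁ x)) (sym e) (internalChildren-pos≥ (suc pos) _ w))))
  internalChildren-injective pos nx (node s us ∷ v) (node s' us' ∷ w) e with List.∷-injective e
  ... | refl , e′ = cong (node s us ∷_) (internalChildren-injective (suc pos) _ v w e′)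

  internalChildren-internal : ∀ pos nx {k} (v : Vec Tm k) → All IsInternalChild (internalChildren pos nx v)
  internalChildren-internal pos nx []               = []
  internalChildren-internal pos nx (leaf ∷ ts)      = internalChildren-internal (suc pos) _ ts
  internalChildren-internal pos nx (node s us ∷ ts) = refl ∷ internalChildren-internal (suc pos) _ ts

  module TiltFacts (r : Rearrangement) (r-internals : PreservesInternals r) (X : ℕ → Bool) where
    open Tilt Σ r X public

    branch : Bool → Rearrangement
    branch b = if b then r else (λ v → v)

    internals-branch : ∀ b {k} (v : Vec Tm k) → internals (branch b v) ≡ internals v
    internals-branch true  v = r-internals v
    internals-branch false v = refl

    degs-branch : ∀ b {k} (v : Vec Tm k) → degs Σ (branch b v) ≡ degs Σ v
    degs-branch b v = degs-resp-internals (branch b v) v (internals-branch b v)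

    dcs-branch : ∀ b {k} (v : Vec Tm k) → dcs Σ (branch b v) ≡ dcs Σ v
    dcs-branch b v = dcs-resp-internals (branch b v) v (internals-branch b v)

    mutual
      deg-go : ∀ n t → deg Σ (go n t) ≡ deg Σ t
      deg-go n leaf        = refl
      deg-go n (node s ts) = cong suc (trans (degs-branch (X n) (gos (suc n) ts)) (degs-gos (suc n) ts))

      degs-gos : ∀ {k} nx (v : Vec Tm k) → degs Σ (gos nx v) ≡ degs Σ v
      degs-gos nx []       = refl
      degs-gos nx (t ∷ ts) = cong₂ _+_ (deg-go nx t) (degs-gos _ ts)

    mutual
      dc-go : ∀ n t → dc Σ (go n t) ≡ dc Σ t
      dc-go n leaf        = refl
      dc-go n (node s ts) = cong (s ∷_) (trans (dcs-branch (X n) (gos (suc n) ts)) (dcs-gos (suc n) ts))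

      dcs-gos : ∀ {k} nx (v : Vec Tm k) → dcs Σ (gos nx v) ≡ dcs Σ v
      dcs-gos nx []       = refl
      dcs-gos nx (t ∷ ts) = cong₂ _++_ (dc-go nx t) (dcs-gos _ ts)

    goNumbered : ℕ × Tm → ℕ × Tm
    goNumbered (m , c) = m , go m c

    numbered-gos : ∀ {k} nx (v : Vec Tm k) → numbered nx (internals (gos nx v)) ≡ map goNumbered (numbered nx (internals v))
    numbered-gos nx []               = refl
    numbered-gos nx (leaf ∷ ts)      rewrite ℕ.+-identityʳ nx = numbered-gos nx ts
    numbered-gos nx (node s us ∷ ts) rewrite deg-go nx (node s us) = cong (_ ∷_) (numbered-gos _ ts)

    internals-gos : ∀ {k} nx (v : Vec Tm k) → internals (gos nx v) ≡ map proj₂ (map goNumbered (numbered nx (internals v)))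
    internals-gos nx v = trans (sym (map-proj₂-numbered nx _)) (cong (map proj₂) (numbered-gos nx v))

    internalChildren-branch-gos : ∀ b pos nx {k} (v : Vec Tm k) →
      map proj₂ (internalChildren pos nx (branch b (gos nx v))) ≡ map goNumbered (numbered nx (internals v))
    internalChildren-branch-gos b pos nx v =
      trans (map-proj₂-internalChildren pos nx (branch b (gos nx v)))
            (trans (cong (numbered nx) (internals-branch b (gos nx v))) (numbered-gos nx v))

    positions-gos : ∀ pos nx {k} (v : Vec Tm k) →
      map proj₁ (internalChildren pos nx (gos nx v)) ≡ map proj₁ (internalChildren pos nx v)
    positions-gos pos nx []               = refl
    positions-gos pos nx (leaf ∷ ts)      = positions-gos (suc pos) _ ts
    positions-gos pos nx (node s us ∷ ts) rewrite deg-go nx (node s us) = cong (pos ∷_) (positions-gos (suc pos) _ ts)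

  module _ {r r' : Rearrangement} (r-internals : PreservesInternals r) (r'-internals : PreservesInternals r')
           (r-determined : DeterminedByInternals r) (X : ℕ → Bool) where
    private
      module T  = TiltFacts r r-internals X
      module T' = TiltFacts r' r'-internals X

    mutual
      go-absorbs : ∀ n t → T.go n (T'.go n t) ≡ T.go n t
      go-absorbs n leaf        = refl
      go-absorbs n (node s ts) with X n
      ... | true  = cong (node s) (r-determined _ _ (begin
        internals (T.gos (suc n) (r' (T'.gos (suc n) ts)))
          ≡⟨ T.internals-gos (suc n) (r' (T'.gos (suc n) ts)) ⟩
        map proj₂ (map T.goNumbered (numbered (suc n) (internals (r' (T'.gos (suc n) ts)))))
          ≡⟨ cong (map proj₂ ∘ map T.goNumbered ∘ numbered (suc n)) (r'-internals _) ⟩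
        map proj₂ (map T.goNumbered (numbered (suc n) (internals (T'.gos (suc n) ts))))
          ≡⟨ T.internals-gos (suc n) (T'.gos (suc n) ts) ⟨
        internals (T.gos (suc n) (T'.gos (suc n) ts))
          ≡⟨ cong internals (gos-absorbs (suc n) ts) ⟩
        internals (T.gos (suc n) ts) ∎))
        where open ≡-Reasoning
      ... | false = cong (node s) (gos-absorbs (suc n) ts)

      gos-absorbs : ∀ {k} nx (v : Vec Tm k) → T.gos nx (T'.gos nx v) ≡ T.gos nx v
      gos-absorbs nx []       = refl
      gos-absorbs nx (t ∷ ts) rewrite T'.deg-go nx t = cong₂ _∷_ (go-absorbs nx t) (gos-absorbs _ ts)

  info-shift : ∀ n p a {l l'} t → l' ≤ l → Pointwise _≤ᵉ_ (info Σ n p l a t) (info Σ n p l' a t)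
  info-shift n p a leaf        _    = []
  info-shift n p a (node s ts) l'≤l = sameParent (ℕ.∸-monoʳ-≤ a l'≤l) ∷ ≤ᵉ*-refl

  infos-shift : ∀ pn ar {pos pos'} nx {k} (v : Vec Tm k) → pos' ≤ pos →
    Pointwise _≤ᵉ_ (infos Σ pn ar pos nx v) (infos Σ pn ar pos' nx v)
  infos-shift pn ar nx []       _    = []
  infos-shift pn ar nx (t ∷ ts) p'≤p = Pointwise.++⁺ (info-shift nx pn ar t p'≤p) (infos-shift pn ar _ ts (s≤s p'≤p))

  infos-∷ʳ-leaf : ∀ pn ar pos nx {k} (v : Vec Tm k) → infos Σ pn ar pos nx (v ∷ʳ leaf) ≡ infos Σ pn ar pos nx v
  infos-∷ʳ-leaf pn ar pos nx []       = refl
  infos-∷ʳ-leaf pn ar pos nx (t ∷ ts) = cong (info Σ nx pn pos ar t ++_) (infos-∷ʳ-leaf pn ar (suc pos) _ ts)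

  infos-leavesRight : ∀ pn ar pos nx {k} (v : Vec Tm k) →
    Pointwise _≤ᵉ_ (infos Σ pn ar pos nx v) (infos Σ pn ar pos nx (leavesRight Σ v))
  infos-leavesRight pn ar pos nx []               = []
  infos-leavesRight pn ar pos nx (leaf ∷ ts)      rewrite ℕ.+-identityʳ nx | infos-∷ʳ-leaf pn ar pos nx (leavesRight Σ ts) =
    ≤ᵉ*-trans (infos-shift pn ar nx ts (ℕ.n≤1+n pos)) (infos-leavesRight pn ar pos nx ts)
  infos-leavesRight pn ar pos nx (node s us ∷ ts) = Pointwise.++⁺ ≤ᵉ*-refl (infos-leavesRight pn ar (suc pos) _ ts)

  infos-insertAfterLeaves : ∀ pn ar pos nx {k} c (v : Vec Tm k) →
    Pointwise _≤ᵉ_ (infos Σ pn ar pos nx (insertAfterLeaves Σ c v)) (infos Σ pn ar pos nx (c ∷ v))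
  infos-insertAfterLeaves pn ar pos nx c []               = ≤ᵉ*-refl
  infos-insertAfterLeaves pn ar pos nx c (node s us ∷ ts) = ≤ᵉ*-refl
  infos-insertAfterLeaves pn ar pos nx c (leaf ∷ ts)      rewrite ℕ.+-identityʳ nx | ℕ.+-identityʳ (nx + deg Σ c) =
    ≤ᵉ*-trans (infos-insertAfterLeaves pn ar (suc pos) nx c ts)
              (Pointwise.++⁺ (info-shift nx pn ar c (ℕ.n≤1+n pos)) ≤ᵉ*-refl)

  infos-leavesLeft : ∀ pn ar pos nx {k} (v : Vec Tm k) →
    Pointwise _≤ᵉ_ (infos Σ pn ar pos nx (leavesLeft Σ v)) (infos Σ pn ar pos nx v)
  infos-leavesLeft pn ar pos nx []               = []
  infos-leavesLeft pn ar pos nx (leaf ∷ ts)      = infos-leavesLeft pn ar (suc pos) _ ts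
  infos-leavesLeft pn ar pos nx (node s us ∷ ts) =
    ≤ᵉ*-trans (infos-insertAfterLeaves pn ar pos nx (node s us) (leavesLeft Σ ts))
              (Pointwise.++⁺ ≤ᵉ*-refl (infos-leavesLeft pn ar (suc pos) _ ts))

  module InfoGo {R : Entry → Entry → Set} (R-refl : ∀ {e} → R e e)
                (R-trans : ∀ {e e' e''} → R e e' → R e' e'' → R e e'')
                (r : Rearrangement) (r-internals : PreservesInternals r) (X : ℕ → Bool)
                (infos-r : ∀ pn ar nx {k} (v : Vec Tm k) → Pointwise R (infos Σ pn ar 1 nx v) (infos Σ pn ar 1 nx (r v)))
                where
    open TiltFacts r r-internals X

    infos-branch : ∀ b pn ar nx {k} (v : Vec Tm k) → Pointwise R (infos Σ pn ar 1 nx v) (infos Σ pn ar 1 nx (branch b v))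
    infos-branch true  = infos-r
    infos-branch false _ _ _ _ = Pointwise.refl R-refl

    mutual
      info-go : ∀ n p l a t → Pointwise R (info Σ n p l a t) (info Σ n p l a (go n t))
      info-go n p l a leaf        = []
      info-go n p l a (node s ts) =
        R-refl ∷ Pointwise.transitive R-trans (infos-gos n (arity Σ s) 1 (suc n) ts)
                                              (infos-branch (X n) n (arity Σ s) (suc n) (gos (suc n) ts))

      infos-gos : ∀ pn ar pos nx {k} (v : Vec Tm k) → Pointwise R (infos Σ pn ar pos nx v) (infos Σ pn ar pos nx (gos nx v))
      infos-gos pn ar pos nx []       = []
      infos-gos pn ar pos nx (t ∷ ts) rewrite deg-go nx t = Pointwise.++⁺ (info-go nx pn pos ar t) (infos-gos pn ar (suc pos) _ ts)

  ≤ᵉ⇒≼ : ∀ {t u} → dc Σ t ≡ dc Σ u → Pointwise _≤ᵉ_ (parentInfo Σ t) (parentInfo Σ u) → _≼_ Σ t u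
  ≤ᵉ⇒≼ dc≡ r = dc≡ , Pointwise.map⁺ entryValue entryValue (Pointwise.map ≤ᵉ⇒entryValue≤ r)

  mutual
    length-info : ∀ n p l a t → length (info Σ n p l a t) ≡ deg Σ t
    length-info n p l a leaf        = refl
    length-info n p l a (node s ts) = cong suc (length-infos n (arity Σ s) 1 (suc n) ts)

    length-infos : ∀ pn ar pos nx {k} (v : Vec Tm k) → length (infos Σ pn ar pos nx v) ≡ degs Σ v
    length-infos pn ar pos nx []       = refl
    length-infos pn ar pos nx (t ∷ ts) =
      trans (List.length-++ (info Σ nx pn pos ar t)) (cong₂ _+_ (length-info nx pn pos ar t) (length-infos pn ar (suc pos) _ ts))

  childInfo : ℕ → ℕ → ℕ × ℕ × Tm → List Entry
  childInfo pn ar (q , m , c) = info Σ m pn q ar c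

  ChildInfo≤ : ℕ → ℕ → ℕ × ℕ × Tm → ℕ × ℕ × Tm → Set
  ChildInfo≤ pn ar e e' = Pointwise _≤ᵉ_ (childInfo pn ar e) (childInfo pn ar e')

  infos-internalChildren : ∀ pn ar pos nx {k} (v : Vec Tm k) →
    infos Σ pn ar pos nx v ≡ concat (map (childInfo pn ar) (internalChildren pos nx v))
  infos-internalChildren pn ar pos nx []               = refl
  infos-internalChildren pn ar pos nx (leaf ∷ ts)      = infos-internalChildren pn ar (suc pos) _ ts
  infos-internalChildren pn ar pos nx (node s us ∷ ts) =
    cong (info Σ nx pn pos ar (node s us) ++_) (infos-internalChildren pn ar (suc pos) _ ts)

  mutual
    info-parents≥ : ∀ {b} n p l a t → b ≤ p → b ≤ n → All (λ e → b ≤ parent e) (info Σ n p l a t)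
    info-parents≥ n p l a leaf        _   _   = []
    info-parents≥ n p l a (node s ts) b≤p b≤n =
      b≤p ∷ infos-parents≥ n (arity Σ s) 1 (suc n) ts b≤n (ℕ.m≤n⇒m≤1+n b≤n)

    infos-parents≥ : ∀ {b} pn ar pos nx {k} (v : Vec Tm k) → b ≤ pn → b ≤ nx →
      All (λ e → b ≤ parent e) (infos Σ pn ar pos nx v)
    infos-parents≥ pn ar pos nx []       _    _    = []
    infos-parents≥ pn ar pos nx (t ∷ ts) b≤pn b≤nx = AllP.++⁺ (info-parents≥ nx pn pos ar t b≤pn b≤nx)
      (infos-parents≥ pn ar (suc pos) _ ts b≤pn (ℕ.≤-trans b≤nx (ℕ.m≤m+n nx _)))

  private
    module ParentSegments (pn : ℕ) = Segments {R = _≤ᵉ_} parent pn ≤ᵉ⇒parent≡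

  -- Each internal child contributes one segment to infos: its own entry, whose parent is pn,
  -- followed by the entries of its descendants, whose parents are at least nx > pn.
  internalChildren-segments : ∀ pn ar pos nx {k} (v : Vec Tm k) → pn < nx →
    All (ParentSegments.Segment pn) (map (childInfo pn ar) (internalChildren pos nx v))
  internalChildren-segments pn ar pos nx []               _     = []
  internalChildren-segments pn ar pos nx (leaf ∷ ts)      pn<nx =
    internalChildren-segments pn ar (suc pos) _ ts (ℕ.≤-trans pn<nx (ℕ.m≤m+n nx 0))
  internalChildren-segments pn ar pos nx (node s us ∷ ts) pn<nx =
    (refl , All.map (λ nx≤p p≡pn → ℕ.<-irrefl (sym p≡pn) (ℕ.<-≤-trans pn<nx nx≤p))
                    (infos-parents≥ nx (arity Σ s) 1 (suc nx) us ℕ.≤-refl (ℕ.n≤1+n nx)))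
    ∷ internalChildren-segments pn ar (suc pos) _ ts (ℕ.≤-trans pn<nx (ℕ.m≤m+n nx _))

  infos-split : ∀ pn ar pos nx {k} (v w : Vec Tm k) → pn < nx →
    Pointwise _≤ᵉ_ (infos Σ pn ar pos nx v) (infos Σ pn ar pos nx w) →
    Pointwise (ChildInfo≤ pn ar)
              (internalChildren pos nx v) (internalChildren pos nx w)
  infos-split pn ar pos nx v w pn<nx r = Pointwise.map⁻ (childInfo pn ar) (childInfo pn ar)
    (ParentSegments.concat⁻ pn (internalChildren-segments pn ar pos nx v pn<nx) (internalChildren-segments pn ar pos nx w pn<nx)
      (subst₂ (Pointwise _≤ᵉ_) (infos-internalChildren pn ar pos nx v) (infos-internalChildren pn ar pos nx w) r))

  childInfo-≤ᵉ⇒positions : ∀ {pn ar K K'} → All IsInternalChild K →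
    Pointwise (ChildInfo≤ pn ar) K K' →
    Pointwise (λ q q' → ar ∸ q ≤ ar ∸ q') (map proj₁ K) (map proj₁ K')
  childInfo-≤ᵉ⇒positions [] [] = []
  childInfo-≤ᵉ⇒positions {K = (_ , _ , node _ _) ∷ _} {(_ , _ , node _ _) ∷ _} (_ ∷ internal) ((sameParent h ∷ _) ∷ rs) =
    h ∷ childInfo-≤ᵉ⇒positions internal rs

  -- Two numbered children whose parent entries compare, whatever their positions.
  InfoLe : ℕ → ℕ → ℕ × Tm → ℕ × Tm → Set
  InfoLe pn ar (m , c) (m' , c') = ∃[ q ] ∃[ q' ] Pointwise _≤ᵉ_ (info Σ m pn q ar c) (info Σ m' pn q' ar c')

  InfoLe⇒deg≡ : ∀ {pn ar m m' c c'} → InfoLe pn ar (m , c) (m' , c') → deg Σ c ≡ deg Σ c'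
  InfoLe⇒deg≡ {pn} {ar} {m} {m'} {c} {c'} (q , q' , r) =
    trans (sym (length-info m pn q ar c)) (trans (Pointwise.Pointwise-length r) (length-info m' pn q' ar c'))

  childInfo-≤ᵉ⇒InfoLe : ∀ {pn ar K K'} → Pointwise (ChildInfo≤ pn ar) K K' →
    Pointwise (InfoLe pn ar) (map proj₂ K) (map proj₂ K')
  childInfo-≤ᵉ⇒InfoLe = Pointwise.map⁺ proj₂ proj₂ ∘ Pointwise.map (λ {(q , _)} {(q' , _)} r → q , q' , r)

  module _ (X : ℕ → Bool) where
    private
      module R = TiltFacts (leavesRight Σ) internals-leavesRight X
      module L = TiltFacts (leavesLeft Σ) internals-leavesLeft X

    info≤info-tlt : ∀ n p l a t → Pointwise _≤ᵉ_ (info Σ n p l a t) (info Σ n p l a (R.go n t))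
    info≤info-tlt = InfoGo.info-go ≤ᵉ-refl ≤ᵉ-trans (leavesRight Σ) internals-leavesRight X
      (λ pn ar nx → infos-leavesRight pn ar 1 nx)

    info-tltʳ≤info : ∀ n p l a t → Pointwise _≤ᵉ_ (info Σ n p l a (L.go n t)) (info Σ n p l a t)
    info-tltʳ≤info n p l a t = Pointwise.symmetric (λ r → r)
      (InfoGo.info-go {R = flip _≤ᵉ_} ≤ᵉ-refl (flip ≤ᵉ-trans) (leavesLeft Σ) internals-leavesLeft X
        (λ pn ar nx v → Pointwise.symmetric (λ r → r) (infos-leavesLeft pn ar 1 nx v)) n p l a t)

    parentInfo-≤ᵉ-tlt : ∀ t → Pointwise _≤ᵉ_ (parentInfo Σ t) (parentInfo Σ (tlt Σ X t))
    parentInfo-≤ᵉ-tlt leaf        = []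
    parentInfo-≤ᵉ-tlt (node s ts) = info≤info-tlt 1 1 0 (arity Σ s) (node s ts)

    parentInfo-tltʳ-≤ᵉ : ∀ t → Pointwise _≤ᵉ_ (parentInfo Σ (tltʳ Σ X t)) (parentInfo Σ t)
    parentInfo-tltʳ-≤ᵉ leaf        = []
    parentInfo-tltʳ-≤ᵉ (node s ts) = info-tltʳ≤info 1 1 0 (arity Σ s) (node s ts)

    tltʳ≼ : ∀ t → _≼_ Σ (tltʳ Σ X t) t
    tltʳ≼ t = ≤ᵉ⇒≼ (L.dc-go 1 t) (parentInfo-tltʳ-≤ᵉ t)

    ≼tlt : ∀ t → _≼_ Σ t (tlt Σ X t)
    ≼tlt t = ≤ᵉ⇒≼ (sym (R.dc-go 1 t)) (parentInfo-≤ᵉ-tlt t)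

    tltʳ∘tlt : ∀ t → tltʳ Σ X (tlt Σ X t) ≡ tltʳ Σ X t
    tltʳ∘tlt = go-absorbs internals-leavesLeft internals-leavesRight leavesLeft-determined X 1

    ≡[]⇒tltʳ≡ : ∀ {t t'} → _≡[_]_ Σ t X t' → tltʳ Σ X t ≡ tltʳ Σ X t'
    ≡[]⇒tltʳ≡ {t} {t'} e = trans (sym (tltʳ∘tlt t)) (trans (cong (tltʳ Σ X) e) (tltʳ∘tlt t'))

    BetweenDeterminesTlt : ℕ × Tm → Set
    BetweenDeterminesTlt (m , c) = ∀ {pn ar} c' → dc Σ c ≡ dc Σ c' →
      InfoLe pn ar (m , L.go m c) (m , c') → InfoLe pn ar (m , c') (m , R.go m c) → R.go m c' ≡ R.go m c

    -- Corresponding children get the same preorder number, because the induction hypothesis makes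
    -- their degrees agree one child at a time.
    numbered-between⇒goNumbered≡ : ∀ {pn ar nx nx'} cs cs' → nx ≡ nx' → All BetweenDeterminesTlt (numbered nx cs) →
      Pointwise (InfoLe pn ar) (map L.goNumbered (numbered nx cs)) (numbered nx' cs') →
      Pointwise (InfoLe pn ar) (numbered nx' cs') (map R.goNumbered (numbered nx cs)) →
      concat (map (dc Σ) cs) ≡ concat (map (dc Σ) cs') →
      map R.goNumbered (numbered nx' cs') ≡ map R.goNumbered (numbered nx cs)
    numbered-between⇒goNumbered≡ [] [] _ _ _ _ _ = refl
    numbered-between⇒goNumbered≡ {nx = nx} (c ∷ cs) (c' ∷ cs') refl (ih ∷ ihs) (l ∷ ls) (r ∷ rs) dc≡ =
      cong₂ _∷_ (cong (nx ,_) (ih c' (proj₁ split) l r))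
                (numbered-between⇒goNumbered≡ cs cs' (cong (_+_ nx) deg≡) ihs ls rs (proj₂ split))
      where
      deg≡ : deg Σ c ≡ deg Σ c'
      deg≡ = trans (sym (L.deg-go nx c)) (InfoLe⇒deg≡ l)
      split : dc Σ c ≡ dc Σ c' × concat (map (dc Σ) cs) ≡ concat (map (dc Σ) cs')
      split = ++-injective (dc Σ c) (dc Σ c') (trans (length-dc c) (trans deg≡ (sym (length-dc c')))) dc≡

    -- Without rearrangement at the parent both tilts keep the positions of the internal children,
    -- and the entries of ts' are squeezed between theirs.
    between⇒positions≡ : ∀ n {k} (ts ts' : Vec Tm k) →
      Pointwise _≤ᵉ_ (infos Σ n k 1 (suc n) (L.gos (suc n) ts)) (infos Σ n k 1 (suc n) ts') →
      Pointwise _≤ᵉ_ (infos Σ n k 1 (suc n) ts') (infos Σ n k 1 (suc n) (R.gos (suc n) ts)) →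
      map proj₁ (internalChildren 1 (suc n) ts') ≡ map proj₁ (internalChildren 1 (suc n) ts)
    between⇒positions≡ n {k} ts ts' h₁ h₂ = sym (∸-injective* (positions≤k ts) (positions≤k ts')
      (subst (λ P → Pointwise _ P _) (L.positions-gos 1 (suc n) ts)
        (childInfo-≤ᵉ⇒positions (internalChildren-internal 1 (suc n) (L.gos (suc n) ts))
          (infos-split n k 1 (suc n) (L.gos (suc n) ts) ts' (ℕ.n<1+n n) h₁)))
      (subst (Pointwise _ _) (R.positions-gos 1 (suc n) ts)
        (childInfo-≤ᵉ⇒positions (internalChildren-internal 1 (suc n) ts')
          (infos-split n k 1 (suc n) ts' (R.gos (suc n) ts) (ℕ.n<1+n n) h₂))))
      where
      positions≤k : ∀ (v : Vec Tm k) → All (_≤ k) (map proj₁ (internalChildren 1 (suc n) v))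
      positions≤k v = AllP.map⁺ (All.map ℕ.≤-pred (internalChildren-pos< 1 (suc n) v))

    mutual
      between⇒tlt≡ : ∀ n {p a l₁ l₂ l₃ l₄} t t' → dc Σ t ≡ dc Σ t' →
        Pointwise _≤ᵉ_ (info Σ n p l₁ a (L.go n t)) (info Σ n p l₂ a t') →
        Pointwise _≤ᵉ_ (info Σ n p l₃ a t') (info Σ n p l₄ a (R.go n t)) →
        R.go n t' ≡ R.go n t
      between⇒tlt≡ n leaf leaf _ _ _ = refl
      between⇒tlt≡ n (node s ts) (node s' ts') dc≡ (_ ∷ h₁) (_ ∷ h₂) with List.∷-injective dc≡
      ... | refl , dcs≡ = cong (node s) (children-between⇒tlt≡ n (X n) ts ts' dcs≡ h₁ h₂)

      children-between⇒goNumbered≡ : ∀ n b {k} (ts ts' : Vec Tm k) → dcs Σ ts ≡ dcs Σ ts' →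
        Pointwise _≤ᵉ_ (infos Σ n k 1 (suc n) (L.branch b (L.gos (suc n) ts))) (infos Σ n k 1 (suc n) ts') →
        Pointwise _≤ᵉ_ (infos Σ n k 1 (suc n) ts') (infos Σ n k 1 (suc n) (R.branch b (R.gos (suc n) ts))) →
        map R.goNumbered (numbered (suc n) (internals ts')) ≡ map R.goNumbered (numbered (suc n) (internals ts))
      children-between⇒goNumbered≡ n b {k} ts ts' dcs≡ h₁ h₂ =
        numbered-between⇒goNumbered≡ (internals ts) (internals ts') refl (children-betweenDeterminesTlt (suc n) ts)
          (subst₂ (Pointwise (InfoLe n k)) (L.internalChildren-branch-gos b 1 (suc n) ts) (map-proj₂-internalChildren 1 (suc n) ts')
            (childInfo-≤ᵉ⇒InfoLe (infos-split n k 1 (suc n) (L.branch b (L.gos (suc n) ts)) ts' (ℕ.n<1+n n) h₁)))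
          (subst₂ (Pointwise (InfoLe n k)) (map-proj₂-internalChildren 1 (suc n) ts') (R.internalChildren-branch-gos b 1 (suc n) ts)
            (childInfo-≤ᵉ⇒InfoLe (infos-split n k 1 (suc n) ts' (R.branch b (R.gos (suc n) ts)) (ℕ.n<1+n n) h₂)))
          (trans (sym (dcs-internals ts)) (trans dcs≡ (dcs-internals ts')))

      children-between⇒tlt≡ : ∀ n b {k} (ts ts' : Vec Tm k) → dcs Σ ts ≡ dcs Σ ts' →
        Pointwise _≤ᵉ_ (infos Σ n k 1 (suc n) (L.branch b (L.gos (suc n) ts))) (infos Σ n k 1 (suc n) ts') →
        Pointwise _≤ᵉ_ (infos Σ n k 1 (suc n) ts') (infos Σ n k 1 (suc n) (R.branch b (R.gos (suc n) ts))) →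
        R.branch b (R.gos (suc n) ts') ≡ R.branch b (R.gos (suc n) ts)
      children-between⇒tlt≡ n true ts ts' dcs≡ h₁ h₂ = leavesRight-determined (R.gos (suc n) ts') (R.gos (suc n) ts)
        (trans (R.internals-gos (suc n) ts')
          (trans (cong (map proj₂) (children-between⇒goNumbered≡ n true ts ts' dcs≡ h₁ h₂))
                 (sym (R.internals-gos (suc n) ts))))
      children-between⇒tlt≡ n false ts ts' dcs≡ h₁ h₂ =
        internalChildren-injective 1 (suc n) (R.gos (suc n) ts') (R.gos (suc n) ts) (map-proj₁-proj₂-injective
          (trans (R.positions-gos 1 (suc n) ts')
            (trans (between⇒positions≡ n ts ts' h₁ h₂) (sym (R.positions-gos 1 (suc n) ts))))
          (trans (R.internalChildren-branch-gos false 1 (suc n) ts')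
            (trans (children-between⇒goNumbered≡ n false ts ts' dcs≡ h₁ h₂)
                   (sym (R.internalChildren-branch-gos false 1 (suc n) ts)))))

      children-betweenDeterminesTlt : ∀ nx {k} (ts : Vec Tm k) → All BetweenDeterminesTlt (numbered nx (internals ts))
      children-betweenDeterminesTlt nx []               = []
      children-betweenDeterminesTlt nx (leaf ∷ ts)      = children-betweenDeterminesTlt nx ts
      children-betweenDeterminesTlt nx (node s us ∷ ts) =
        (λ c' dc≡ (_ , _ , l) (_ , _ , r) → between⇒tlt≡ nx (node s us) c' dc≡ l r) ∷ children-betweenDeterminesTlt _ ts

    root-between⇒tlt≡ : ∀ t t' → dc Σ t ≡ dc Σ t' →
      Pointwise _≤ᵉ_ (parentInfo Σ (tltʳ Σ X t)) (parentInfo Σ t') →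
      Pointwise _≤ᵉ_ (parentInfo Σ t') (parentInfo Σ (tlt Σ X t)) →
      tlt Σ X t' ≡ tlt Σ X t
    root-between⇒tlt≡ leaf        leaf          _   _  _  = refl
    root-between⇒tlt≡ (node s ts) (node s' ts') dc≡ h₁ h₂ with List.∷-injectiveˡ dc≡
    ... | refl = between⇒tlt≡ 1 (node s ts) (node s ts') dc≡ h₁ h₂

    between⇒≡[] : ∀ {t t'} → _≼_ Σ (tltʳ Σ X t) t' → _≼_ Σ t' (tlt Σ X t) → _≡[_]_ Σ t X t'
    between⇒≡[] {t} {t'} (dc≡ , v₁) (_ , v₂) =
      sym (root-between⇒tlt≡ t t' (trans (sym (L.dc-go 1 t)) dc≡) (proj₁ entries) (proj₂ entries))
      where
      entries : Pointwise _≤ᵉ_ (parentInfo Σ (tltʳ Σ X t)) (parentInfo Σ t') × Pointwise _≤ᵉ_ (parentInfo Σ t') (parentInfo Σ (tlt Σ X t))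
      entries = sandwich (≤ᵉ*-trans (parentInfo-tltʳ-≤ᵉ t) (parentInfo-≤ᵉ-tlt t)) v₁ v₂

proposition2p3p4 : (Σ : Signature) (X : ℕ → Bool) (t t' : Term Σ) →
    (_≡[_]_ Σ t X t') ⇔ (_≼_ Σ (tltʳ Σ X t) t' × _≼_ Σ t' (tlt Σ X t))
proposition2p3p4 Σ X t t' = mk⇔
  (λ t≡t' → subst (λ u → _≼_ Σ u t') (sym (≡[]⇒tltʳ≡ Σ X t≡t')) (tltʳ≼ Σ X t')
          , subst (_≼_ Σ t') (sym t≡t') (≼tlt Σ X t'))
  (λ (lower , upper) → between⇒≡[] Σ X lower upper)
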